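{- For all non-negative integers $k$ and $q$, \[ c_{k+q}=\sum_{n=0}^{k}\sum_{m=0}^{q}\frac{s_{q}(k,n)\,s(q,m)}{n+m+1}. \]
   Context: The Cauchy numbers $c_n$ are defined by $\frac{x}{\ln(1+x)}=\sum_{n\ge0}\frac{c_n}{n!}x^n$; equivalently $c_n=\int_0^1 z(z-1)\cdots(z-n+1)\,dz$. The signed Stirling numbers of the first kind $s(n,k)$ are defined by $z(z-1)\cdots(z-n+1)=\sum_{k=0}^n s(n,k)z^k$. For an integer $r\ge0$, the $r$-Stirling numbers of the second kind $S_r(n,k)$ are defined by $\frac{(e^t-1)^k}{k!}e^{rt}=\sum_{n\ge k}S_r(n,k)\frac{t^n}{n!}$, and the (signed) $r$-Stirling numbers of the first kind $s_r(n,k)$ are the inverse array: $a_n=\sum_{k=0}^nS_r(n,k)b_k$ for all $n\ge0$ iff $b_n=\sum_{k=0}^n s_r(n,k)a_k$ for all $n\ge0$; equivalently $(y-r)(y-r-1)\cdots(y-r-n+1)=\sum_{k=0}^n s_r(n,k)y^k$. In particular $s_0(n,k)=s(n,k)$ and $s_1(n,k)=s(n+1,k+1)$. -}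

module Defs where

open import Data.Nat using (ℕ; zero; suc)
open import Data.Integer using (ℤ; +_; -_; _-_; _*_)
open import Data.Rational using (ℚ; _/_; _+_; _*_; 0ℚ)

sumTo : ℕ → (ℕ → ℚ) → ℚ
sumTo zero    f = f 0
sumTo (suc n) f = sumTo n f + f (suc n)

-- Signed r-Stirling numbers of the first kind, as coefficients of
-- (y-r)(y-r-1)...(y-r-n+1) = Σ_k sr r n k y^k
-- (multiplying by (y - (r+n)) gives the recurrence below).
sr : ℕ → ℕ → ℕ → ℤ
sr r zero    zero    = + 1
sr r zero    (suc k) = + 0
sr r (suc n) zero    = - (+ (r Data.Nat.+ n) Data.Integer.* sr r n zero)
sr r (suc n) (suc k) = sr r n k - (+ (r Data.Nat.+ n) Data.Integer.* sr r n (suc k))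

s : ℕ → ℕ → ℤ
s = sr 0

-- Cauchy numbers  c_n = ∫_0^1 z(z-1)...(z-n+1) dz = Σ_{k=0}^n s(n,k)/(k+1)
cauchy : ℕ → ℚ
cauchy n = sumTo n (λ k → s n k / suc k)

{-# OPTIONS --safe #-}
-- Cauchy numbers are moments: c_N = L ((y)_N) for the functional L (y ^ j) = 1 / (j + 1), integration
-- over [0, 1], where (y)_N = y (y - 1) ⋯ (y - N + 1). The identity is L applied to the factorisation
-- (y)_{k+q} = (y - q)_k · (y)_q, whose two factors have coefficients s_q(k, n) and s(q, m). Multiplying
-- a polynomial by y - c amounts to replacing L by p ↦ L ((y - c) p), so the factorisation can be
-- established under L by peeling off one linear factor at a time.
module Submission where

open import Defs
open import Data.Nat using (ℕ; suc; _+_)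
open import Data.Integer using (_*_)
open import Data.Rational using (ℚ; _/_)
open import Relation.Binary.PropositionalEquality using (_≡_)

open import Function using (_∘_)
open import Relation.Binary.PropositionalEquality using (refl; sym; trans; cong; cong₂; module ≡-Reasoning)
import Data.Nat as ℕ
import Data.Nat.Properties as ℕ
import Data.Integer as ℤ
import Data.Integer.Properties as ℤ
import Data.Rational as Q
import Data.Rational.Properties as Q
import Data.Rational.Unnormalised as Qᵘ
import Data.Rational.Unnormalised.Properties as Qᵘ
open import Data.Rational.Solver using (module +-*-Solver)

open ≡-Reasoning

fromℚᵘ-homo-+ : ∀ p q → Q.fromℚᵘ (p Qᵘ.+ q) ≡ Q.fromℚᵘ p Q.+ Q.fromℚᵘ q
fromℚᵘ-homo-+ p q = begin
  Q.fromℚᵘ (p Qᵘ.+ q)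
    ≡⟨ Q.fromℚᵘ-cong (Qᵘ.+-cong (Qᵘ.≃-sym (Q.toℚᵘ-fromℚᵘ p)) (Qᵘ.≃-sym (Q.toℚᵘ-fromℚᵘ q))) ⟩
  Q.fromℚᵘ (Q.toℚᵘ (Q.fromℚᵘ p) Qᵘ.+ Q.toℚᵘ (Q.fromℚᵘ q))
    ≡⟨ Q.fromℚᵘ-cong (Qᵘ.≃-sym (Q.toℚᵘ-homo-+ (Q.fromℚᵘ p) (Q.fromℚᵘ q))) ⟩
  Q.fromℚᵘ (Q.toℚᵘ (Q.fromℚᵘ p Q.+ Q.fromℚᵘ q))
    ≡⟨ Q.fromℚᵘ-toℚᵘ _ ⟩
  Q.fromℚᵘ p Q.+ Q.fromℚᵘ q ∎

fromℚᵘ-homo-* : ∀ p q → Q.fromℚᵘ (p Qᵘ.* q) ≡ Q.fromℚᵘ p Q.* Q.fromℚᵘ q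
fromℚᵘ-homo-* p q = begin
  Q.fromℚᵘ (p Qᵘ.* q)
    ≡⟨ Q.fromℚᵘ-cong (Qᵘ.*-cong (Qᵘ.≃-sym (Q.toℚᵘ-fromℚᵘ p)) (Qᵘ.≃-sym (Q.toℚᵘ-fromℚᵘ q))) ⟩
  Q.fromℚᵘ (Q.toℚᵘ (Q.fromℚᵘ p) Qᵘ.* Q.toℚᵘ (Q.fromℚᵘ q))
    ≡⟨ Q.fromℚᵘ-cong (Qᵘ.≃-sym (Q.toℚᵘ-homo-* (Q.fromℚᵘ p) (Q.fromℚᵘ q))) ⟩
  Q.fromℚᵘ (Q.toℚᵘ (Q.fromℚᵘ p Q.* Q.fromℚᵘ q))
    ≡⟨ Q.fromℚᵘ-toℚᵘ _ ⟩
  Q.fromℚᵘ p Q.* Q.fromℚᵘ q ∎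

fromℚᵘ-homo‿- : ∀ p → Q.fromℚᵘ (Qᵘ.- p) ≡ Q.- Q.fromℚᵘ p
fromℚᵘ-homo‿- p = begin
  Q.fromℚᵘ (Qᵘ.- p)
    ≡⟨ Q.fromℚᵘ-cong (Qᵘ.-‿cong (Qᵘ.≃-sym (Q.toℚᵘ-fromℚᵘ p))) ⟩
  Q.fromℚᵘ (Qᵘ.- Q.toℚᵘ (Q.fromℚᵘ p))
    ≡⟨ Q.fromℚᵘ-cong (Qᵘ.≃-sym (Q.toℚᵘ-homo‿- (Q.fromℚᵘ p))) ⟩
  Q.fromℚᵘ (Q.toℚᵘ (Q.- Q.fromℚᵘ p))
    ≡⟨ Q.fromℚᵘ-toℚᵘ _ ⟩
  Q.- Q.fromℚᵘ p ∎

fromℤ : ℤ.ℤ → ℚ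
fromℤ i = i / 1

fromℕ : ℕ → ℚ
fromℕ n = fromℤ (ℤ.+ n)

fromℤ-homo-* : ∀ i j → fromℤ (i * j) ≡ fromℤ i Q.* fromℤ j
fromℤ-homo-* i j = fromℚᵘ-homo-* (Qᵘ.mkℚᵘ i 0) (Qᵘ.mkℚᵘ j 0)

fromℤ-homo‿- : ∀ i → fromℤ (ℤ.- i) ≡ Q.- fromℤ i
fromℤ-homo‿- i = fromℚᵘ-homo‿- (Qᵘ.mkℚᵘ i 0)

fromℤ-homo-+ : ∀ i j → fromℤ (i ℤ.+ j) ≡ fromℤ i Q.+ fromℤ j
fromℤ-homo-+ i j = trans (Q.fromℚᵘ-cong {Qᵘ.mkℚᵘ (i ℤ.+ j) 0} {Qᵘ.mkℚᵘ i 0 Qᵘ.+ Qᵘ.mkℚᵘ j 0} (Qᵘ.*≡* cross))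
                         (fromℚᵘ-homo-+ (Qᵘ.mkℚᵘ i 0) (Qᵘ.mkℚᵘ j 0))
  where
  cross : (i ℤ.+ j) * ℤ.+ 1 ≡ (i * ℤ.+ 1 ℤ.+ j * ℤ.+ 1) * ℤ.+ 1
  cross rewrite ℤ.*-identityʳ i | ℤ.*-identityʳ j = refl

fromℤ-homo-- : ∀ i j → fromℤ (i ℤ.- j) ≡ fromℤ i Q.- fromℤ j
fromℤ-homo-- i j = trans (fromℤ-homo-+ i (ℤ.- j)) (cong (fromℤ i Q.+_) (fromℤ-homo‿- j))

/-as-* : ∀ i t → i / suc t ≡ fromℤ i Q.* (ℤ.+ 1 / suc t)
/-as-* i t = trans (Q.fromℚᵘ-cong {Qᵘ.mkℚᵘ i t} {Qᵘ.mkℚᵘ i 0 Qᵘ.* Qᵘ.mkℚᵘ (ℤ.+ 1) t} (Qᵘ.*≡* cross))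
                   (fromℚᵘ-homo-* (Qᵘ.mkℚᵘ i 0) (Qᵘ.mkℚᵘ (ℤ.+ 1) t))
  where
  cross : i * ℤ.+ suc (t ℕ.+ 0) ≡ (i * ℤ.+ 1) * ℤ.+ suc t
  cross rewrite ℕ.+-identityʳ t | ℤ.*-identityʳ i = refl

sumTo-cong : ∀ N {f g : ℕ → ℚ} → (∀ j → f j ≡ g j) → sumTo N f ≡ sumTo N g
sumTo-cong ℕ.zero    f≗g = f≗g 0
sumTo-cong (suc N) f≗g = cong₂ Q._+_ (sumTo-cong N f≗g) (f≗g (suc N))

sumTo-suc-head : ∀ N (f : ℕ → ℚ) → sumTo (suc N) f ≡ f 0 Q.+ sumTo N (f ∘ suc)
sumTo-suc-head ℕ.zero    f = refl
sumTo-suc-head (suc N) f = begin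
  sumTo (suc N) f Q.+ f (suc (suc N))              ≡⟨ cong (Q._+ f (suc (suc N))) (sumTo-suc-head N f) ⟩
  (f 0 Q.+ sumTo N (f ∘ suc)) Q.+ f (suc (suc N))  ≡⟨ Q.+-assoc (f 0) _ _ ⟩
  f 0 Q.+ sumTo (suc N) (f ∘ suc)                  ∎

*-distribˡ-sumTo : ∀ N c (f : ℕ → ℚ) → c Q.* sumTo N f ≡ sumTo N (λ j → c Q.* f j)
*-distribˡ-sumTo ℕ.zero    c f = refl
*-distribˡ-sumTo (suc N) c f = trans (Q.*-distribˡ-+ c (sumTo N f) (f (suc N)))
  (cong (Q._+ c Q.* f (suc N)) (*-distribˡ-sumTo N c f))

sumTo-sub-scaled : ∀ N c (f g : ℕ → ℚ) →
  sumTo N (λ j → f j Q.- c Q.* g j) ≡ sumTo N f Q.- c Q.* sumTo N g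
sumTo-sub-scaled ℕ.zero    c f g = refl
sumTo-sub-scaled (suc N) c f g = trans
  (cong (Q._+ (f (suc N) Q.- c Q.* g (suc N))) (sumTo-sub-scaled N c f g))
  (solve 5 (λ c F G x y → (F :- c :* G) :+ (x :- c :* y) := (F :+ x) :- c :* (G :+ y))
     refl c (sumTo N f) (sumTo N g) (f (suc N)) (g (suc N)))
  where open +-*-Solver

*-distribˡ-sub-scaled : ∀ c x y z → x Q.* (y Q.- c Q.* z) ≡ x Q.* y Q.- c Q.* (x Q.* z)
*-distribˡ-sub-scaled = solve 4 (λ c x y z → x :* (y :- c :* z) := x :* y :- c :* (x :* z)) refl
  where open +-*-Solver

-- A sequence a : ℕ → ℚ stands for the polynomial Σ a j y ^ j, a sequence v : ℕ → ℚ for the linear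
-- functional L on ℚ[y] with moments v j = L (y ^ j); dotTo N a v = L a when a has degree at most N.
-- timesRoot c a is (y - c) a; timesRootᵀ c v and timesᵀ d a v are the moments of p ↦ L ((y - c) p)
-- and of p ↦ L (a p).
dotTo : ℕ → (ℕ → ℚ) → (ℕ → ℚ) → ℚ
dotTo N a v = sumTo N (λ j → a j Q.* v j)

timesRoot : ℚ → (ℕ → ℚ) → ℕ → ℚ
timesRoot c a ℕ.zero    = Q.- (c Q.* a 0)
timesRoot c a (suc j) = a j Q.- c Q.* a (suc j)

timesRootᵀ : ℚ → (ℕ → ℚ) → ℕ → ℚ
timesRootᵀ c v j = v (suc j) Q.- c Q.* v j

timesᵀ : ℕ → (ℕ → ℚ) → (ℕ → ℚ) → ℕ → ℚ
timesᵀ d a v n = sumTo d (λ m → a m Q.* v (n + m))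

dotTo-timesRoot : ∀ N c a v → a (suc N) ≡ Q.0ℚ →
  dotTo (suc N) (timesRoot c a) v ≡ dotTo N a (timesRootᵀ c v)
dotTo-timesRoot N c a v a-top≡0 = begin
  dotTo (suc N) (timesRoot c a) v
    ≡⟨ sumTo-suc-head N _ ⟩
  Q.- (c Q.* a 0) Q.* v 0 Q.+ sumTo N (λ j → (a j Q.- c Q.* a (suc j)) Q.* v (suc j))
    ≡⟨ cong (Q.- (c Q.* a 0) Q.* v 0 Q.+_) (trans
         (sumTo-cong N (λ j → solve 4 (λ c x y z → (x :- c :* y) :* z := x :* z :- c :* (y :* z))
                                 refl c (a j) (a (suc j)) (v (suc j))))
         (sumTo-sub-scaled N c _ _)) ⟩
  Q.- (c Q.* a 0) Q.* v 0 Q.+ (Shifted Q.- c Q.* Tail)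
    ≡⟨ solve 5 (λ c a0 v0 S T → (:- (c :* a0)) :* v0 :+ (S :- c :* T) := S :- c :* (a0 :* v0 :+ T))
         refl c (a 0) (v 0) Shifted Tail ⟩
  Shifted Q.- c Q.* (a 0 Q.* v 0 Q.+ Tail)
    ≡⟨ cong (λ x → Shifted Q.- c Q.* x) (sym dotTo-head) ⟩
  Shifted Q.- c Q.* dotTo N a v
    ≡⟨ sym (sumTo-sub-scaled N c _ _) ⟩
  sumTo N (λ j → a j Q.* v (suc j) Q.- c Q.* (a j Q.* v j))
    ≡⟨ sumTo-cong N (λ j → sym (*-distribˡ-sub-scaled c (a j) (v (suc j)) (v j))) ⟩
  dotTo N a (timesRootᵀ c v) ∎
  where
  open +-*-Solver
  Shifted Tail : ℚ
  Shifted = sumTo N (λ j → a j Q.* v (suc j))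
  Tail    = sumTo N (λ j → a (suc j) Q.* v (suc j))
  dotTo-head : dotTo N a v ≡ a 0 Q.* v 0 Q.+ Tail
  dotTo-head = begin
    dotTo N a v                          ≡⟨ sym (Q.+-identityʳ _) ⟩
    dotTo N a v Q.+ Q.0ℚ                 ≡⟨ cong (dotTo N a v Q.+_) (sym top-term≡0) ⟩
    dotTo (suc N) a v                    ≡⟨ sumTo-suc-head N _ ⟩
    a 0 Q.* v 0 Q.+ Tail                 ∎
    where
    top-term≡0 : a (suc N) Q.* v (suc N) ≡ Q.0ℚ
    top-term≡0 = trans (cong (Q._* v (suc N)) a-top≡0) (Q.*-zeroˡ (v (suc N)))

timesRootᵀ-timesᵀ : ∀ c d a v n → timesRootᵀ c (timesᵀ d a v) n ≡ timesᵀ d a (timesRootᵀ c v) n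
timesRootᵀ-timesᵀ c d a v n = begin
  timesᵀ d a v (suc n) Q.- c Q.* timesᵀ d a v n
    ≡⟨ sym (sumTo-sub-scaled d c _ _) ⟩
  sumTo d (λ m → a m Q.* v (suc (n + m)) Q.- c Q.* (a m Q.* v (n + m)))
    ≡⟨ sumTo-cong d (λ m → sym (*-distribˡ-sub-scaled c (a m) (v (suc (n + m))) (v (n + m)))) ⟩
  timesᵀ d a (timesRootᵀ c v) n ∎

sr-vanishes : ∀ r {N k} → N ℕ.< k → sr r N k ≡ ℤ.+ 0
sr-vanishes r {ℕ.zero}  {suc k} _ = refl
sr-vanishes r {suc N} {suc k} (ℕ.s≤s N<k)
  rewrite sr-vanishes r N<k | sr-vanishes r (ℕ.m<n⇒m<1+n N<k) | ℤ.*-zeroʳ (ℤ.+ (r + N)) = refl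

fallingCoeff : ℕ → ℕ → ℕ → ℚ
fallingCoeff r N j = fromℤ (sr r N j)

fallingCoeff-suc : ∀ r N j → fallingCoeff r (suc N) j ≡ timesRoot (fromℕ (r + N)) (fallingCoeff r N) j
fallingCoeff-suc r N ℕ.zero =
  trans (fromℤ-homo‿- (ℤ.+ (r + N) * sr r N 0)) (cong Q.-_ (fromℤ-homo-* (ℤ.+ (r + N)) (sr r N 0)))
fallingCoeff-suc r N (suc j) =
  trans (fromℤ-homo-- (sr r N j) (ℤ.+ (r + N) * sr r N (suc j)))
        (cong (λ x → fallingCoeff r N j Q.- x) (fromℤ-homo-* (ℤ.+ (r + N)) (sr r N (suc j))))

dotTo-fallingCoeff-suc : ∀ r N v →
  dotTo (suc N) (fallingCoeff r (suc N)) v ≡ dotTo N (fallingCoeff r N) (timesRootᵀ (fromℕ (r + N)) v)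
dotTo-fallingCoeff-suc r N v = begin
  dotTo (suc N) (fallingCoeff r (suc N)) v
    ≡⟨ sumTo-cong (suc N) (λ j → cong (Q._* v j) (fallingCoeff-suc r N j)) ⟩
  dotTo (suc N) (timesRoot (fromℕ (r + N)) (fallingCoeff r N)) v
    ≡⟨ dotTo-timesRoot N _ (fallingCoeff r N) v (cong fromℤ (sr-vanishes r (ℕ.n<1+n N))) ⟩
  dotTo N (fallingCoeff r N) (timesRootᵀ (fromℕ (r + N)) v) ∎

dotTo-fallingCoeff-split : ∀ r q k v →
  dotTo (k + q) (fallingCoeff r (k + q)) v ≡ dotTo k (fallingCoeff (r + q) k) (timesᵀ q (fallingCoeff r q) v)
dotTo-fallingCoeff-split r q ℕ.zero    v = sym (Q.*-identityˡ _)
dotTo-fallingCoeff-split r q (suc k) v = begin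
  dotTo (suc (k + q)) (fallingCoeff r (suc (k + q))) v
    ≡⟨ dotTo-fallingCoeff-suc r (k + q) v ⟩
  dotTo (k + q) (fallingCoeff r (k + q)) (timesRootᵀ (fromℕ (r + (k + q))) v)
    ≡⟨ dotTo-fallingCoeff-split r q k _ ⟩
  dotTo k (fallingCoeff (r + q) k) (timesᵀ q (fallingCoeff r q) (timesRootᵀ (fromℕ (r + (k + q))) v))
    ≡⟨ cong (λ n → dotTo k (fallingCoeff (r + q) k) (timesᵀ q (fallingCoeff r q) (timesRootᵀ (fromℕ n) v)))
            r+k+q≡r+q+k ⟩
  dotTo k (fallingCoeff (r + q) k) (timesᵀ q (fallingCoeff r q) (timesRootᵀ (fromℕ (r + q + k)) v))
    ≡⟨ sumTo-cong k (λ j → cong (fallingCoeff (r + q) k j Q.*_)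
                                (sym (timesRootᵀ-timesᵀ (fromℕ (r + q + k)) q (fallingCoeff r q) v j))) ⟩
  dotTo k (fallingCoeff (r + q) k) (timesRootᵀ (fromℕ (r + q + k)) (timesᵀ q (fallingCoeff r q) v))
    ≡⟨ sym (dotTo-fallingCoeff-suc (r + q) k _) ⟩
  dotTo (suc k) (fallingCoeff (r + q) (suc k)) (timesᵀ q (fallingCoeff r q) v) ∎
  where
  r+k+q≡r+q+k : r + (k + q) ≡ r + q + k
  r+k+q≡r+q+k = trans (cong (r +_) (ℕ.+-comm k q)) (sym (ℕ.+-assoc r q k))

harmonic : ℕ → ℚ
harmonic j = ℤ.+ 1 / suc j

mainTheorem5 : (k q : ℕ) →
    cauchy (k + q) ≡ sumTo k (λ n → sumTo q (λ m → (sr q k n * s q m) / suc (n + m)))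
mainTheorem5 k q = begin
  cauchy (k + q)
    ≡⟨ sumTo-cong (k + q) (λ j → /-as-* (s (k + q) j) j) ⟩
  dotTo (k + q) (fallingCoeff 0 (k + q)) harmonic
    ≡⟨ dotTo-fallingCoeff-split 0 q k harmonic ⟩
  dotTo k (fallingCoeff q k) (timesᵀ q (fallingCoeff 0 q) harmonic)
    ≡⟨ sumTo-cong k (λ n → trans (*-distribˡ-sumTo q (fallingCoeff q k n) _) (sumTo-cong q (term n))) ⟩
  sumTo k (λ n → sumTo q (λ m → (sr q k n * s q m) / suc (n + m))) ∎
  where
  term : ∀ n m → fallingCoeff q k n Q.* (fallingCoeff 0 q m Q.* harmonic (n + m))
                 ≡ (sr q k n * s q m) / suc (n + m)
  term n m = sym (begin
    (sr q k n * s q m) / suc (n + m)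
      ≡⟨ /-as-* (sr q k n * s q m) (n + m) ⟩
    fromℤ (sr q k n * s q m) Q.* harmonic (n + m)
      ≡⟨ cong (Q._* harmonic (n + m)) (fromℤ-homo-* (sr q k n) (s q m)) ⟩
    fallingCoeff q k n Q.* fallingCoeff 0 q m Q.* harmonic (n + m)
      ≡⟨ Q.*-assoc (fallingCoeff q k n) (fallingCoeff 0 q m) (harmonic (n + m)) ⟩
    fallingCoeff q k n Q.* (fallingCoeff 0 q m Q.* harmonic (n + m)) ∎)
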